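{- Let $G$ be an almost-spider graph. Then $\sigma_T(G)\le 3$.
   Context: All graphs are finite and simple. A spider is a graph whose vertex set is partitioned into sets $\mathcal{S},\mathcal{K},\mathcal{R}$ such that: $\mathcal{K}$ is a clique, $\mathcal{S}$ is an independent set and $|\mathcal{S}|=|\mathcal{K}|\ge 2$; every vertex of $\mathcal{R}$ is adjacent to all vertices of $\mathcal{K}$ and to no vertex of $\mathcal{S}$; and there is a bijection $f:\mathcal{S}\to\mathcal{K}$ such that either $N(x)=\{f(x)\}$ for all $x\in\mathcal{S}$ (a thin spider) or $N(x)=\mathcal{K}\setminus\{f(x)\}$ for all $x\in\mathcal{S}$ (a thick spider). An almost-spider is a graph obtained from a spider by adding a new vertex $v'$ that is a false twin (same open neighbourhood, nonadjacent) or a true twin (same closed neighbourhood, adjacent) of some vertex $v\in\mathcal{S}\cup\mathcal{K}$. A tree $t$-spanner of a connected graph $G$ is a spanning tree $T$ of $G$ such that $d_T(u,v)\le t$ for every edge $uv$ of $G$; the stretch index $\sigma_T(G)$ is the smallest $t$ for which $G$ has a tree $t$-spanner. -}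

module Defs where

open import Data.Nat using (ℕ; zero; suc; _≤_)
open import Data.Fin using (Fin; punchIn)
open import Data.Bool using (Bool; true; false)
open import Data.List using (List; []; _∷_; _++_; [_]; length)
open import Data.List.Relation.Unary.Unique.Propositional using (Unique)
open import Data.List.Relation.Unary.Linked using (Linked)
open import Data.Product using (Σ; _×_; ∃; ∃-syntax; _,_)
open import Data.Sum using (_⊎_)
open import Relation.Nullary using (¬_)
open import Relation.Binary.PropositionalEquality using (_≡_; _≢_)

record Graph (n : ℕ) : Set where
  field
    adj    : Fin n → Fin n → Bool
    sym    : ∀ u v → adj u v ≡ adj v u
    irrefl : ∀ u → adj u u ≡ false

open Graph public

E : ∀ {n} → Graph n → Fin n → Fin n → Set
E G u v = adj G u v ≡ true

data Walk {n} (G : Graph n) : Fin n → Fin n → ℕ → Set where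
  here : ∀ {u} → Walk G u u zero
  step : ∀ {u w v k} → E G u w → Walk G w v k → Walk G u v (suc k)

DistLe : ∀ {n} → Graph n → Fin n → Fin n → ℕ → Set
DistLe G u v t = ∃[ k ] (k ≤ t × Walk G u v k)

Connected : ∀ {n} → Graph n → Set
Connected G = ∀ u v → ∃[ k ] Walk G u v k

IsCycle : ∀ {n} → Graph n → Fin n → List (Fin n) → Set
IsCycle G x xs =
  Unique (x ∷ xs) × (2 ≤ length xs) × Linked (E G) (x ∷ xs ++ [ x ])

Acyclic : ∀ {n} → Graph n → Set
Acyclic G = ∀ x xs → ¬ IsCycle G x xs

IsTree : ∀ {n} → Graph n → Set
IsTree T = Connected T × Acyclic T

IsTreeSpanner : ∀ {n} → Graph n → Graph n → ℕ → Set
IsTreeSpanner G T t =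
  (∀ u v → E T u v → E G u v) × IsTree T × (∀ u v → E G u v → DistLe T u v t)

data Part : Set where
  S K R : Part

record Spider {n : ℕ} (G : Graph n) : Set where
  field
    part   : Fin n → Part
    f      : Fin n → Fin n          -- the bijection S → K (values off S irrelevant)
    f-K    : ∀ x → part x ≡ S → part (f x) ≡ K
    f-inj  : ∀ x y → part x ≡ S → part y ≡ S → f x ≡ f y → x ≡ y
    f-surj : ∀ k → part k ≡ K → ∃[ x ] (part x ≡ S × f x ≡ k)
    two-S  : ∃[ x ] ∃[ y ] (part x ≡ S × part y ≡ S × x ≢ y)
    K-clique : ∀ u v → part u ≡ K → part v ≡ K → u ≢ v → E G u v
    S-indep  : ∀ u v → part u ≡ S → part v ≡ S → ¬ E G u v
    R-K      : ∀ r k → part r ≡ R → part k ≡ K → E G r k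
    R-S      : ∀ r s → part r ≡ R → part s ≡ S → ¬ E G r s
    legs     : (∀ x y → part x ≡ S → (E G x y → y ≡ f x) × (y ≡ f x → E G x y))   -- thin
             ⊎ (∀ x y → part x ≡ S →
                  (E G x y → part y ≡ K × y ≢ f x) × (part y ≡ K × y ≢ f x → E G x y)) -- thick

delete : ∀ {n} → Graph (suc n) → Fin (suc n) → Graph n
delete G w = record
  { adj    = λ x y → adj G (punchIn w x) (punchIn w y)
  ; sym    = λ x y → sym G (punchIn w x) (punchIn w y)
  ; irrefl = λ x → irrefl G (punchIn w x)
  }

-- G is obtained from a spider by adding a false or true twin w of a vertex of S ∪ K
AlmostSpider : ∀ {n} → Graph (suc n) → Set
AlmostSpider {n} G =
  Σ (Fin (suc n)) λ w →
  Σ (Spider (delete G w)) λ sp →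
  Σ (Fin n) λ v →
    (Spider.part sp v ≡ S ⊎ Spider.part sp v ≡ K)
    × (∀ y → y ≢ v → adj G w (punchIn w y) ≡ adj G (punchIn w v) (punchIn w y))
    -- (w adjacent to v: true twin; w not adjacent to v: false twin)

{-# OPTIONS --safe #-}
-- Root a spanning tree of depth two at a clique vertex c ≠ v: every vertex of K ∪ R hangs
-- from c, every leg x ∈ S from a K-neighbour of x, and the twin w from the parent of v.
-- The tree of any parent map is acyclic, since the depth strictly decreases along parent
-- steps and a non-backtracking closed walk would have to turn from going down to going up.
-- In a tree of depth two, u and y are at distance at most 3 as soon as one of them is a
-- child of the root or they are siblings, and every edge of G is of that kind: S is
-- independent, so an edge has an end in K ∪ R, and the edges at w mirror those at v.
module Submission where

open import Data.Bool using (true; if_then_else_)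
open import Data.Fin using (Fin; _≟_; punchIn; punchOut)
open import Data.Fin.Properties using (punchInᵢ≢i; punchIn-punchOut; punchOut-punchIn)
open import Data.List using ([]; _∷_; _++_; [_])
open import Data.List.Membership.Propositional using (_∈_)
open import Data.List.Relation.Unary.All as All using (All; _∷_)
open import Data.List.Relation.Unary.Any using (here; there)
open import Data.List.Relation.Unary.AllPairs using (_∷_)
open import Data.List.Relation.Unary.Linked using (Linked; [-]; _∷_)
open import Data.List.Relation.Unary.Unique.Propositional using (Unique)
open import Data.Nat using (ℕ; suc; _+_; _≤_; _<_; z≤n; s≤s)
open import Data.Nat.Properties using (≤-refl; ≤-trans; +-mono-≤; +-comm; <-trans; <-irrefl; m<m+n)
open import Data.Product using (∃-syntax; _×_; _,_; proj₁; proj₂)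
open import Data.Sum using (_⊎_; inj₁; inj₂)
import Data.Sum as Sum
open import Defs hiding (sym)
open import Function using (_∘_; mk⇔)
open import Relation.Binary.PropositionalEquality using (_≡_; _≢_; refl; sym; trans; cong; subst)
open import Relation.Nullary using (¬_; Dec; yes; no; does; contradiction; ¬?; _×-dec_; _⊎-dec_)
open import Relation.Nullary.Decidable using (dec-true; dec-false; does-⇔)

module _ {n : ℕ} {G : Graph n} where

  E-sym : ∀ {u v} → E G u v → E G v u
  E-sym {u} {v} e = trans (Graph.sym G v u) e

  E-irrefl : ∀ {u} → ¬ E G u u
  E-irrefl {u} e with trans (sym e) (irrefl G u)
  ... | ()

  walk-++ : ∀ {u v w j k} → Walk G u v j → Walk G v w k → Walk G u w (j + k)
  walk-++ here q = q
  walk-++ (step e p) q = step e (walk-++ p q)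

  walk-reverse : ∀ {u v k} → Walk G u v k → Walk G v u k
  walk-reverse here = here
  walk-reverse {k = suc k} (step e p) =
    subst (Walk G _ _) (+-comm k 1) (walk-++ (walk-reverse p) (step (E-sym e) here))

  edge⇒distLe : ∀ {u v} → E G u v → DistLe G u v 1
  edge⇒distLe e = 1 , ≤-refl , step e here

  distLe-refl : ∀ {u k} → DistLe G u u k
  distLe-refl = 0 , z≤n , here

  distLe-trans : ∀ {u v w j k} → DistLe G u v j → DistLe G v w k → DistLe G u w (j + k)
  distLe-trans (j , j≤ , p) (k , k≤ , q) = j + k , +-mono-≤ j≤ k≤ , walk-++ p q

  distLe-sym : ∀ {u v k} → DistLe G u v k → DistLe G v u k
  distLe-sym (j , j≤ , p) = j , j≤ , walk-reverse p

  distLe-mono : ∀ {u v j k} → j ≤ k → DistLe G u v j → DistLe G u v k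
  distLe-mono j≤k (i , i≤ , p) = i , ≤-trans i≤ j≤k , p

module ParentGraph {N : ℕ} (P : Fin N → Fin N) where

  ParentEdge : Fin N → Fin N → Set
  ParentEdge u v = u ≢ v × (P u ≡ v ⊎ P v ≡ u)

  parentEdge-sym : ∀ {u v} → ParentEdge u v → ParentEdge v u
  parentEdge-sym (u≢v , dir) = u≢v ∘ sym , Sum.swap dir

  parentEdge? : ∀ u v → Dec (ParentEdge u v)
  parentEdge? u v = ¬? (u ≟ v) ×-dec (P u ≟ v ⊎-dec P v ≟ u)

  T : Graph N
  T = record
    { adj    = λ u v → does (parentEdge? u v)
    ; sym    = λ u v → does-⇔ (mk⇔ parentEdge-sym parentEdge-sym) (parentEdge? u v) (parentEdge? v u)
    ; irrefl = λ u → dec-false (parentEdge? u u) (λ (u≢u , _) → u≢u refl)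
    }

  edge⇒parentEdge : ∀ {u v} → E T u v → ParentEdge u v
  edge⇒parentEdge {u} {v} = witness (parentEdge? u v)
    where
    witness : ∀ {A : Set} (a? : Dec A) → does a? ≡ true → A
    witness (yes a) _  = a
    witness (no _)  ()

  edge-to-parent : ∀ u → u ≢ P u → E T u (P u)
  edge-to-parent u u≢Pu = dec-true (parentEdge? u (P u)) (u≢Pu , inj₁ refl)

  distLe-parent : ∀ u → DistLe T u (P u) 1
  distLe-parent u with u ≟ P u
  ... | yes u≡Pu = subst (λ x → DistLe T u x 1) u≡Pu distLe-refl
  ... | no u≢Pu = edge⇒distLe (edge-to-parent u u≢Pu)

  module Ranked (rank : Fin N → ℕ) (rank-parent : ∀ u → u ≢ P u → rank (P u) < rank u) where

    edge-direction : ∀ {a b} → E T a b → (P a ≡ b × rank b < rank a) ⊎ (P b ≡ a × rank a < rank b)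
    edge-direction e with edge⇒parentEdge e
    ... | a≢b , inj₁ refl = inj₁ (refl , rank-parent _ a≢b)
    ... | a≢b , inj₂ refl = inj₂ (refl , rank-parent _ (a≢b ∘ sym))

    -- Trail a b z e: a non-backtracking walk a → b → ⋯ → z → e in T.
    data Trail : Fin N → Fin N → Fin N → Fin N → Set where
      edge   : ∀ {a b} → E T a b → Trail a b a b
      extend : ∀ {a b c z e} → E T a b → a ≢ c → Trail b c z e → Trail a b z e

    -- Going down and then up would return to the same vertex, so a trail climbs, then descends.
    trail-shape : ∀ {a b z e} → Trail a b z e →
      (P a ≡ b × rank e < rank a) ⊎ (P a ≡ b × P e ≡ z) ⊎ (P e ≡ z × rank a < rank e)
    trail-shape (edge ab) with edge-direction ab
    ... | inj₁ up = inj₁ up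
    ... | inj₂ down = inj₂ (inj₂ down)
    trail-shape (extend ab a≢c t) with edge-direction ab | trail-shape t
    ... | inj₁ (Pa , r) | inj₁ (_ , r′) = inj₁ (Pa , <-trans r′ r)
    ... | inj₁ (Pa , _) | inj₂ (inj₁ (_ , Pe)) = inj₂ (inj₁ (Pa , Pe))
    ... | inj₁ (Pa , _) | inj₂ (inj₂ (Pe , _)) = inj₂ (inj₁ (Pa , Pe))
    ... | inj₂ (Pb , _) | inj₁ (Pb′ , _) = contradiction (trans (sym Pb) Pb′) a≢c
    ... | inj₂ (Pb , _) | inj₂ (inj₁ (Pb′ , _)) = contradiction (trans (sym Pb) Pb′) a≢c
    ... | inj₂ (_ , r) | inj₂ (inj₂ (Pe , r′)) = inj₂ (inj₂ (Pe , <-trans r r′))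

    closed-trail-backtracks : ∀ {a b z} → Trail a b z a → b ≡ z
    closed-trail-backtracks t with trail-shape t
    ... | inj₁ (_ , r) = contradiction r (<-irrefl refl)
    ... | inj₂ (inj₁ (Pa , Pa′)) = trans (sym Pa) Pa′
    ... | inj₂ (inj₂ (_ , r)) = contradiction r (<-irrefl refl)

    path⇒trail : ∀ {e} a b l → Unique (a ∷ b ∷ l) → All (e ≢_) (a ∷ b ∷ l) →
                 Linked (E T) (a ∷ b ∷ l ++ [ e ]) → ∃[ z ] (z ∈ b ∷ l × Trail a b z e)
    path⇒trail a b [] _ (e≢a ∷ _) (ab ∷ be ∷ [-]) =
      b , here refl , extend ab (e≢a ∘ sym) (edge be)
    path⇒trail a b (c ∷ l) ((_ ∷ a≢c ∷ _) ∷ uniq) (_ ∷ e∉) (ab ∷ linked)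
      with path⇒trail b c l uniq e∉ linked
    ... | z , z∈ , t = z , there z∈ , extend ab a≢c t

    acyclic : Acyclic T
    acyclic x [] (_ , () , _)
    acyclic x (b ∷ []) (_ , s≤s () , _)
    acyclic x (b ∷ c ∷ l) (x∉@(_ ∷ x≢c ∷ _) ∷ uniq@(b∉ ∷ _) , _ , xb ∷ linked)
      with path⇒trail b c l uniq x∉ linked
    ... | z , z∈ , t = All.lookup b∉ z∈ (closed-trail-backtracks (extend xb x≢c t))

  module DepthTwo (c : Fin N) (Pc : P c ≡ c) (PP : ∀ u → P (P u) ≡ c) where

    away : Fin N → ℕ
    away u = if does (u ≟ c) then 0 else 1

    depth : Fin N → ℕ
    depth u = away (P u) + away u

    moved⇒≢root : ∀ {u} → u ≢ P u → u ≢ c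
    moved⇒≢root u≢Pu refl = u≢Pu (sym Pc)

    depth-parent : ∀ u → u ≢ P u → depth (P u) < depth u
    depth-parent u u≢Pu
      rewrite PP u | dec-true (c ≟ c) refl | dec-false (u ≟ c) (moved⇒≢root u≢Pu) =
        m<m+n (away (P u)) (s≤s z≤n)

    distLe-root : ∀ u → DistLe T (P u) c 1
    distLe-root u = subst (λ x → DistLe T (P u) x 1) (PP u) (distLe-parent (P u))

    connected : Connected T
    connected u v with distLe-trans (distLe-trans (distLe-parent u) (distLe-root u))
                                    (distLe-trans (distLe-sym (distLe-root v)) (distLe-sym (distLe-parent v)))
    ... | k , _ , p = k , p

    isTree : IsTree T
    isTree = connected , Ranked.acyclic depth depth-parent

    distLe-child-of-root : ∀ u y → P u ≡ c → DistLe T u y 3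
    distLe-child-of-root u y Pu≡c =
      distLe-trans (distLe-trans (distLe-parent u)
                                 (subst (λ x → DistLe T x (P y) 1) (sym Pu≡c) (distLe-sym (distLe-root y))))
                   (distLe-sym (distLe-parent y))

    distLe-siblings : ∀ u y → P u ≡ P y → DistLe T u y 3
    distLe-siblings u y Pu≡Py =
      distLe-mono (s≤s (s≤s z≤n))
        (distLe-trans (subst (λ x → DistLe T u x 1) Pu≡Py (distLe-parent u)) (distLe-sym (distLe-parent y)))

Near : ∀ {N} → (Fin N → Fin N) → Fin N → Fin N → Fin N → Set
Near P c u y = P u ≡ c ⊎ P y ≡ c ⊎ P u ≡ P y

near-sym : ∀ {N} {P : Fin N → Fin N} {c u y} → Near P c u y → Near P c y u
near-sym (inj₁ Pu≡c) = inj₂ (inj₁ Pu≡c)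
near-sym (inj₂ (inj₁ Py≡c)) = inj₁ Py≡c
near-sym (inj₂ (inj₂ Pu≡Py)) = inj₂ (inj₂ (sym Pu≡Py))

depthTwo-treeSpanner : ∀ {N} (G : Graph N) (P : Fin N → Fin N) (c : Fin N) →
  P c ≡ c → (∀ u → P (P u) ≡ c) → (∀ u → u ≢ P u → E G u (P u)) →
  (∀ u y → E G u y → Near P c u y) → ∃[ T ] IsTreeSpanner G T 3
depthTwo-treeSpanner G P c Pc PP parent-adjacent near = T , T⊆G , isTree , stretch
  where
  open ParentGraph P
  open DepthTwo c Pc PP

  T⊆G : ∀ u y → E T u y → E G u y
  T⊆G u y e with edge⇒parentEdge e
  ... | u≢y , inj₁ refl = parent-adjacent u u≢y
  ... | u≢y , inj₂ refl = E-sym {G = G} (parent-adjacent y (u≢y ∘ sym))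

  stretch : ∀ u y → E G u y → DistLe T u y 3
  stretch u y e with near u y e
  ... | inj₁ Pu≡c = distLe-child-of-root u y Pu≡c
  ... | inj₂ (inj₁ Py≡c) = distLe-sym (distLe-child-of-root y u Py≡c)
  ... | inj₂ (inj₂ Pu≡Py) = distLe-siblings u y Pu≡Py

module SpiderFacts {n : ℕ} {D : Graph n} (sp : Spider D) where
  open Spider sp

  K≢S : ∀ {a} → part a ≡ K → part a ≢ S
  K≢S a∈K a∈S with trans (sym a∈K) a∈S
  ... | ()

  two-K : ∃[ k ] ∃[ k′ ] (part k ≡ K × part k′ ≡ K × k ≢ k′)
  two-K with two-S
  ... | x , y , x∈S , y∈S , x≢y = f x , f y , f-K x x∈S , f-K y y∈S , x≢y ∘ f-inj x y x∈S y∈S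

  K-avoiding : ∀ x → ∃[ k ] (part k ≡ K × k ≢ x)
  K-avoiding x with two-K
  ... | k , k′ , k∈K , k′∈K , k≢k′ with k ≟ x
  ...   | yes refl = k′ , k′∈K , k≢k′ ∘ sym
  ...   | no k≢x = k , k∈K , k≢x

  S-neighbour∈K : ∀ {a b} → part a ≡ S → E D a b → part b ≡ K
  S-neighbour∈K {a} {b} a∈S e with part b in b∈
  ... | K = refl
  ... | S = contradiction e (S-indep a b a∈S b∈)
  ... | R = contradiction (E-sym {G = D} e) (R-S b a b∈ a∈S)

  edge-leaves-S : ∀ {a b} → E D a b → part a ≢ S ⊎ part b ≢ S
  edge-leaves-S {a} e with part a in a∈
  ... | S = inj₂ (K≢S (S-neighbour∈K a∈ e))
  ... | K = inj₁ λ ()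
  ... | R = inj₁ λ ()

  foot : Fin n → Fin n
  foot a with legs
  ... | inj₁ _ = f a
  ... | inj₂ _ = proj₁ (K-avoiding (f a))

  foot∈K : ∀ a → part a ≡ S → part (foot a) ≡ K × E D a (foot a)
  foot∈K a a∈S with legs
  ... | inj₁ thin = f-K a a∈S , proj₂ (thin a (f a) a∈S) refl
  ... | inj₂ thick with K-avoiding (f a)
  ...   | k , k∈K , k≢fa = k∈K , proj₂ (thick a k a∈S) (k∈K , k≢fa)

  module Rooted (c : Fin n) (c∈K : part c ≡ K) where

    attach : Part → Fin n → Fin n
    attach S = foot
    attach K _ = c
    attach R _ = c

    parent : Fin n → Fin n
    parent a = attach (part a) a

    parent-off-S : ∀ a → part a ≢ S → parent a ≡ c
    parent-off-S a a∉S with part a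
    ... | S = contradiction refl a∉S
    ... | K = refl
    ... | R = refl

    parent∈K : ∀ a → part (parent a) ≡ K
    parent∈K a with part a in a∈
    ... | S = proj₁ (foot∈K a a∈)
    ... | K = c∈K
    ... | R = c∈K

    parent-parent : ∀ a → parent (parent a) ≡ c
    parent-parent a = parent-off-S (parent a) (K≢S (parent∈K a))

    parent-adjacent : ∀ a → a ≢ parent a → E D a (parent a)
    parent-adjacent a a≢Pa with part a in a∈
    ... | S = proj₂ (foot∈K a a∈)
    ... | K = K-clique a c a∈ c∈K a≢Pa
    ... | R = R-K a c a∈ c∈K

data PunchView {n : ℕ} (w : Fin (suc n)) : Fin (suc n) → Set where
  new : PunchView w w
  old : ∀ a → PunchView w (punchIn w a)

punchView : ∀ {n} (w z : Fin (suc n)) → PunchView w z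
punchView w z with w ≟ z
... | yes refl = new
... | no w≢z = subst (PunchView w) (punchIn-punchOut w≢z) (old (punchOut w≢z))

module AlmostSpiderTree {n : ℕ} (G : Graph (suc n)) (w : Fin (suc n)) (sp : Spider (delete G w)) (v : Fin n)
         (v∈S⊎K : Spider.part sp v ≡ S ⊎ Spider.part sp v ≡ K)
         (twin : ∀ y → y ≢ v → adj G w (punchIn w y) ≡ adj G (punchIn w v) (punchIn w y)) where

  open Spider sp using (part)
  open SpiderFacts sp

  -- c ≢ v: the twin w hangs from parent v, which must then be a neighbour of w.
  c : Fin n
  c = proj₁ (K-avoiding v)

  c∈K : part c ≡ K
  c∈K = proj₁ (proj₂ (K-avoiding v))

  c≢v : c ≢ v
  c≢v = proj₂ (proj₂ (K-avoiding v))

  open Rooted c c∈K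

  P : Fin (suc n) → Fin (suc n)
  P z with w ≟ z
  ... | yes _ = punchIn w (parent v)
  ... | no w≢z = punchIn w (parent (punchOut w≢z))

  P-new : P w ≡ punchIn w (parent v)
  P-new with w ≟ w
  ... | yes _ = refl
  ... | no w≢w = contradiction refl w≢w

  P-old : ∀ a → P (punchIn w a) ≡ punchIn w (parent a)
  P-old a with w ≟ punchIn w a
  ... | yes w≡a = contradiction (sym w≡a) (punchInᵢ≢i w a)
  ... | no _ = cong (punchIn w ∘ parent) (punchOut-punchIn w)

  P-old-off-S : ∀ a → part a ≢ S → P (punchIn w a) ≡ punchIn w c
  P-old-off-S a a∉S = trans (P-old a) (cong (punchIn w) (parent-off-S a a∉S))

  P-root : P (punchIn w c) ≡ punchIn w c
  P-root = P-old-off-S c (K≢S c∈K)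

  P-P : ∀ u → P (P u) ≡ punchIn w c
  P-P u with punchView w u
  ... | new rewrite P-new | P-old (parent v) = cong (punchIn w) (parent-parent v)
  ... | old a rewrite P-old a | P-old (parent a) = cong (punchIn w) (parent-parent a)

  v≢parent : v ≢ parent v
  v≢parent = Sum.[ in-S , in-K ]′ v∈S⊎K
    where
    in-S : part v ≡ S → v ≢ parent v
    in-S v∈S v≡Pv = K≢S (parent∈K v) (trans (cong part (sym v≡Pv)) v∈S)
    in-K : part v ≡ K → v ≢ parent v
    in-K v∈K v≡Pv = c≢v (trans (sym (parent-off-S v (K≢S v∈K))) (sym v≡Pv))

  P-adjacent : ∀ u → u ≢ P u → E G u (P u)
  P-adjacent u u≢Pu with punchView w u
  ... | new rewrite P-new = trans (twin (parent v) (v≢parent ∘ sym)) (parent-adjacent v v≢parent)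
  ... | old a rewrite P-old a = parent-adjacent a (u≢Pu ∘ cong (punchIn w))

  near-new : ∀ b → E G w (punchIn w b) → Near P (punchIn w c) w (punchIn w b)
  near-new b e = by-cases v∈S⊎K (b ≟ v)
    where
    by-cases : part v ≡ S ⊎ part v ≡ K → Dec (b ≡ v) → Near P (punchIn w c) w (punchIn w b)
    by-cases (inj₂ v∈K) _ = inj₁ (trans P-new (cong (punchIn w) (parent-off-S v (K≢S v∈K))))
    by-cases (inj₁ _) (yes refl) = inj₂ (inj₂ (trans P-new (sym (P-old b))))
    by-cases (inj₁ v∈S) (no b≢v) =
      inj₂ (inj₁ (P-old-off-S b (K≢S (S-neighbour∈K v∈S (trans (sym (twin b b≢v)) e)))))

  near : ∀ u y → E G u y → Near P (punchIn w c) u y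
  near u y e with punchView w u | punchView w y
  ... | new | new = contradiction e (E-irrefl {G = G})
  ... | new | old b = near-new b e
  ... | old a | new = near-sym {P = P} (near-new a (E-sym {G = G} e))
  ... | old a | old b with edge-leaves-S e
  ...   | inj₁ a∉S = inj₁ (P-old-off-S a a∉S)
  ...   | inj₂ b∉S = inj₂ (inj₁ (P-old-off-S b b∉S))

lemma5 : ∀ {n} (G : Graph (suc n)) → AlmostSpider G → ∃[ T ] IsTreeSpanner G T 3
lemma5 G (w , sp , v , v∈S⊎K , twin) =
  depthTwo-treeSpanner G P (punchIn w c) P-root P-P P-adjacent near
  where open AlmostSpiderTree G w sp v v∈S⊎K twin
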